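{- Let $(H,k,\chi)$ be an instance of Precoloring Extension where $H$ has at least one edge, and consider the $P_n\,|\,\mathrm{conc}\,|\,\sum C_j$ instance and the bound $K$ constructed from it as described in the context. If there is a minimal feasible schedule $C$ for the constructed instance with $\sum C_j\le K$ (sum over all jobs of the constructed instance), then there is a solution $\chi':\{1,\ldots,n\}\to\{1,\ldots,k\}$ for $(H,k,\chi)$.
   Context: Precoloring Extension instance: graph $H=(V,F)$, $V=\{1,\ldots,n\}$, integer $k$, and a proper coloring $\chi:V_0\to\{1,\ldots,k\}$ of $H[V_0]$, $V_0\subseteq V$; a solution is a proper coloring $\chi':V\to\{1,\ldots,k\}$ of $H$ agreeing with $\chi$ on $V_0$. Scheduling: jobs with positive integer processing times $p_j$, release times $0$, conflict graph $G$; a schedule $C$ (completion times in $\mathbb{N}$) is feasible if $C_j-p_j\ge0$ for every job and $[C_i-p_i,C_i)\cap[C_j-p_j,C_j)=\emptyset$ for every edge $\{i,j\}$ of $G$; it is minimal if decreasing the completion time of any single job by any positive amount makes it infeasible. Construction: let $X=nk+1$; start with $G=H$, $p_j=1$ for $j\in V$. Let $u_j=\chi(j)$ for $j\in V_0$ and $u_j=k$ otherwise; $\ell_j=\chi(j)$ for $j\in V_0$ and $\ell_j=1$ otherwise. For each $j\in V$: add jobs $j(1),\ldots,j(X)$, each with processing time $X-u_j$, and edges $\{j,j(i)\}$; for each $i\in\{1,\ldots,X\}$ add jobs $j(i,1),\ldots,j(i,X)$, each with processing time $u_j$, and edges $\{j(i),j(i,i_0)\}$. For each $j\in V_0$ with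 $\chi(j)>1$: add jobs $j^*(1),\ldots,j^*(X)$, each with processing time $\ell_j-1$, and edges $\{j,j^*(i)\}$. No other edges are added. Set $K=\sum_{j=1}^n\big[(1+u_j)X^2+(\ell_j-1)X\big]+nk$. -}

module Defs where

open import Data.Nat using (ℕ; zero; suc; _+_; _*_; _∸_; _≤_; _<_; _<?_)
open import Data.Fin using (Fin; toℕ)
import Data.Fin as F
open import Data.Maybe using (Maybe; just; nothing)
open import Data.Product using (Σ; ∃; _×_; _,_)
open import Data.Sum using (_⊎_)
open import Data.Empty using (⊥)
open import Relation.Nullary using (¬_; yes; no)
open import Relation.Binary.PropositionalEquality using (_≡_; _≢_)

Σ[_]_ : (m : ℕ) → (Fin m → ℕ) → ℕ
Σ[ zero ] f = 0
Σ[ suc m ] f = f F.zero + Σ[ m ] (λ i → f (F.suc i))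

-- Precoloring Extension.  Vertices are Fin n (vertex i stands for toℕ i + 1);
-- colours are Fin k (colour c stands for toℕ c + 1 ∈ {1,…,k}).

record Graph (n : ℕ) : Set₁ where
  field
    Adj   : Fin n → Fin n → Set
    sym   : ∀ {i j} → Adj i j → Adj j i
    irrefl : ∀ {i} → ¬ Adj i i

open Graph public

HasEdge : ∀ {n} → Graph n → Set
HasEdge H = Σ _ λ i → Σ _ λ j → Adj H i j

-- A precolouring: χ i ≡ just c means i ∈ V₀ with colour c; nothing means i ∉ V₀.
Precoloring : ℕ → ℕ → Set
Precoloring n k = Fin n → Maybe (Fin k)

ProperPrecoloring : ∀ {n k} → Graph n → Precoloring n k → Set
ProperPrecoloring H χ = ∀ i j a b → Adj H i j → χ i ≡ just a → χ j ≡ just b → a ≢ b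

IsSolution : ∀ {n k} → Graph n → Precoloring n k → (Fin n → Fin k) → Set
IsSolution H χ χ' =
  (∀ i j → Adj H i j → χ' i ≢ χ' j) × (∀ i c → χ i ≡ just c → χ' i ≡ c)

module Construction (n k : ℕ) (H : Graph n) (χ : Precoloring n k) where

  X : ℕ
  X = n * k + 1

  u : Fin n → ℕ
  u j with χ j
  ... | just c  = suc (toℕ c)
  ... | nothing = k

  ℓ : Fin n → ℕ
  ℓ j with χ j
  ... | just c  = suc (toℕ c)
  ... | nothing = 1

  -- Jobs of the constructed instance.
  --   orig j          : job j ∈ V
  --   mid j i         : job j(i)
  --   leaf j i i₀     : job j(i,i₀)
  --   star j p i      : job j*(i), only for j ∈ V₀ with χ(j) > 1 (i.e. ℓ j > 1)
  data Job : Set where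
    orig : Fin n → Job
    mid  : Fin n → Fin X → Job
    leaf : Fin n → Fin X → Fin X → Job
    star : (j : Fin n) → 1 < ℓ j → Fin X → Job

  p : Job → ℕ
  p (orig j)     = 1
  p (mid j i)    = X ∸ u j
  p (leaf j i i₀) = u j
  p (star j _ i) = ℓ j ∸ 1

  -- Edges of the conflict graph G (each unordered edge listed once;
  -- the non-overlap condition below is symmetric).
  data Edge : Job → Job → Set where
    eH    : ∀ {i j} → Adj H i j → Edge (orig i) (orig j)
    eMid  : ∀ j i → Edge (orig j) (mid j i)
    eLeaf : ∀ j i i₀ → Edge (mid j i) (leaf j i i₀)
    eStar : ∀ j (q : 1 < ℓ j) i → Edge (orig j) (star j q i)

  Schedule : Set
  Schedule = Job → ℕ

  -- [C_a - p_a, C_a) ∩ [C_b - p_b, C_b) = ∅ (intervals with integer endpoints,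
  -- so it suffices to quantify over integer points t)
  Disjoint : Schedule → Job → Job → Set
  Disjoint C a b = ¬ (Σ ℕ λ t → (C a ≤ t + p a) × (t < C a) × (C b ≤ t + p b) × (t < C b))

  Feasible : Schedule → Set
  Feasible C = (∀ a → p a ≤ C a) × (∀ a b → Edge a b → Disjoint C a b)

  Minimal : Schedule → Set
  Minimal C = ∀ a (C' : Schedule) → C' a < C a → (∀ b → b ≢ a → C' b ≡ C b) → ¬ Feasible C'

  starSum : Schedule → Fin n → ℕ
  starSum C j with 1 <? ℓ j
  ... | yes q = Σ[ X ] (λ i → C (star j q i))
  ... | no _  = 0

  TotalCompletion : Schedule → ℕ
  TotalCompletion C = Σ[ n ] λ j →
      C (orig j)
    + Σ[ X ] (λ i → C (mid j i))
    + Σ[ X ] (λ i → Σ[ X ] (λ i₀ → C (leaf j i i₀)))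
    + starSum C j

  K : ℕ
  K = Σ[ n ] (λ j → (1 + u j) * (X * X) + (ℓ j ∸ 1) * X) + n * k

-- The gadget of vertex j (j, its blocks j(i), j(i,·) and its star jobs j*(·))
-- contributes at least (1 + u_j)X² + (ℓ_j − 1)X to ∑ C, and at least X more
-- unless j completes in [ℓ_j, u_j]: completing earlier pushes all X star jobs
-- one unit later, completing in (u_j, X) pushes every block one unit later, and
-- completing at X or later costs X by itself.  The slack nk in K is smaller
-- than X, so every C_j lies in [ℓ_j, u_j] ⊆ [1, k], and C_j is a colouring:
-- adjacent unit jobs cannot share a completion time, and ℓ_j = u_j = χ(j) on V₀.
module Submission where

open import Defs hiding (sym)
open import Data.Nat using (ℕ; zero; suc; _+_; _*_; _∸_; _≤_; _<_; _≤?_; _<?_; z≤n; s≤s; z<s)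
open import Data.Nat.Properties
open import Data.Nat.Tactic.RingSolver using (solve-∀)
open import Data.Fin using (Fin; toℕ; fromℕ<)
import Data.Fin as F
import Data.Fin.Properties as FP
open import Data.Maybe using (just; nothing)
open import Data.Product using (Σ; _×_; _,_; proj₁; proj₂)
open import Data.Sum using (_⊎_; inj₁; inj₂)
import Data.Sum as Sum
open import Data.Empty using (⊥-elim)
open import Relation.Nullary using (¬_; yes; no)
open import Relation.Nullary.Decidable using (_×-dec_)
open import Relation.Binary.PropositionalEquality

+-swapʳ : ∀ a b c → (a + b) + c ≡ (a + c) + b
+-swapʳ = solve-∀

+-rotate : ∀ a b c → (a + b) + c ≡ (c + a) + b
+-rotate = solve-∀

m∸n<m⇒0<n : ∀ m n → m ∸ n < m → 0 < n
m∸n<m⇒0<n m zero    m<m = ⊥-elim (<-irrefl refl m<m)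
m∸n<m⇒0<n m (suc n) _   = z<s

*≤Σ : ∀ m (f : Fin m → ℕ) c → (∀ i → c ≤ f i) → m * c ≤ Σ[ m ] f
*≤Σ zero    f c h = z≤n
*≤Σ (suc m) f c h = +-mono-≤ (h F.zero) (*≤Σ m (λ i → f (F.suc i)) c (λ i → h (F.suc i)))

Σ-mono-≤ : ∀ m (f g : Fin m → ℕ) → (∀ i → f i ≤ g i) → Σ[ m ] f ≤ Σ[ m ] g
Σ-mono-≤ zero    f g h = z≤n
Σ-mono-≤ (suc m) f g h = +-mono-≤ (h F.zero) (Σ-mono-≤ m _ _ (λ i → h (F.suc i)))

Σ-distrib-+ : ∀ m (f g : Fin m → ℕ) → Σ[ m ] f + Σ[ m ] g ≡ Σ[ m ] (λ i → f i + g i)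
Σ-distrib-+ zero    f g = refl
Σ-distrib-+ (suc m) f g =
  trans (interchange (f F.zero) _ (g F.zero) _)
        (cong (f F.zero + g F.zero +_) (Σ-distrib-+ m (λ i → f (F.suc i)) (λ i → g (F.suc i))))
  where
  interchange : ∀ a b c d → (a + b) + (c + d) ≡ (a + c) + (b + d)
  interchange = solve-∀

Σ-mono-≤-with-gap : ∀ m (f g : Fin m → ℕ) d → (∀ i → f i ≤ g i) →
                    (i₀ : Fin m) → f i₀ + d ≤ g i₀ → Σ[ m ] f + d ≤ Σ[ m ] g
Σ-mono-≤-with-gap (suc m) f g d h F.zero gap =
  ≤-trans (≤-reflexive (+-swapʳ (f F.zero) _ d))
          (+-mono-≤ gap (Σ-mono-≤ m _ _ (λ i → h (F.suc i))))
Σ-mono-≤-with-gap (suc m) f g d h (F.suc i₀) gap =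
  ≤-trans (≤-reflexive (+-assoc (f F.zero) _ d))
          (+-mono-≤ (h F.zero)
            (Σ-mono-≤-with-gap m (λ i → f (F.suc i)) (λ i → g (F.suc i)) d
                               (λ i → h (F.suc i)) i₀ gap))

-- The hypothesis says that [sa, sa + pa) and [sb, sb + pb) are disjoint.
starts-ordered : ∀ sa pa sb pb → 1 ≤ pa → 1 ≤ pb →
  ¬ (Σ ℕ λ t → (sa + pa ≤ t + pa) × (t < sa + pa) × (sb + pb ≤ t + pb) × (t < sb + pb)) →
  sa + pa ≤ sb ⊎ sb + pb ≤ sa
starts-ordered sa pa sb pb 1≤pa 1≤pb disjoint with ≤-total sa sb
... | inj₁ sa≤sb with sa + pa ≤? sb
...   | yes a-first = inj₁ a-first
...   | no a-reaches-b =
  ⊥-elim (disjoint (sb , +-monoˡ-≤ pa sa≤sb , ≰⇒> a-reaches-b , ≤-refl , m<m+n sb 1≤pb))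
starts-ordered sa pa sb pb 1≤pa 1≤pb disjoint | inj₂ sb≤sa with sb + pb ≤? sa
...   | yes b-first = inj₂ b-first
...   | no b-reaches-a =
  ⊥-elim (disjoint (sa , ≤-refl , m<m+n sa 1≤pa , +-monoˡ-≤ pb sb≤sa , ≰⇒> b-reaches-a))

completions-ordered : ∀ ca pa cb pb → 1 ≤ pa → 1 ≤ pb → pa ≤ ca → pb ≤ cb →
  ¬ (Σ ℕ λ t → (ca ≤ t + pa) × (t < ca) × (cb ≤ t + pb) × (t < cb)) →
  ca + pb ≤ cb ⊎ cb + pa ≤ ca
completions-ordered ca pa cb pb 1≤pa 1≤pb pa≤ca pb≤cb disjoint
  with ca ∸ pa | m∸n+n≡m pa≤ca | cb ∸ pb | m∸n+n≡m pb≤cb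
... | sa | refl | sb | refl =
  Sum.map (+-monoˡ-≤ pb) (+-monoˡ-≤ pa) (starts-ordered sa pa sb pb 1≤pa 1≤pb disjoint)

module Gadget (n k : ℕ) (H : Graph n) (χ : Precoloring n k) where
  open Construction n k H χ

  u≤k : ∀ j → u j ≤ k
  u≤k j with χ j
  ... | just c  = FP.toℕ<n c
  ... | nothing = ≤-refl

  u-precoloured : ∀ {j c} → χ j ≡ just c → u j ≡ suc (toℕ c)
  u-precoloured eq rewrite eq = refl

  ℓ-precoloured : ∀ {j c} → χ j ≡ just c → ℓ j ≡ suc (toℕ c)
  ℓ-precoloured eq rewrite eq = refl

  k≤nk : Fin n → k ≤ n * k
  k≤nk j = ≤-trans (m≤m+n k _) (*-monoˡ-≤ k (FP.toℕ<n j))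

  u<X : ∀ j → u j < X
  u<X j = ≤-<-trans (≤-trans (u≤k j) (k≤nk j)) (m<m+n (n * k) z<s)

  X∸u+u≡X : ∀ j → (X ∸ u j) + u j ≡ X
  X∸u+u≡X j = m∸n+n≡m (<⇒≤ (u<X j))

  1≤X∸u : ∀ j → 1 ≤ X ∸ u j
  1≤X∸u j = m<n⇒0<n∸m (u<X j)

  X+Xu≤XX : ∀ j → X + X * u j ≤ X * X
  X+Xu≤XX j = ≤-trans (≤-reflexive (sym (*-suc X (u j)))) (*-monoʳ-≤ X (u<X j))

  blocksLower starsLower lower : Fin n → ℕ
  blocksLower j = (1 + u j) * (X * X)
  starsLower j = (ℓ j ∸ 1) * X
  lower j = blocksLower j + starsLower j

  InWindow : Schedule → Fin n → Set
  InWindow C j = ℓ j ≤ C (orig j) × C (orig j) ≤ u j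

  module _ (C : Schedule) (feasible : Feasible C) where
    starts-late : ∀ a → p a ≤ C a
    starts-late = proj₁ feasible

    ordered : ∀ {a b} → Edge a b → 1 ≤ p a → 1 ≤ p b → C a + p b ≤ C b ⊎ C b + p a ≤ C a
    ordered {a} {b} e 1≤pa 1≤pb =
      completions-ordered (C a) (p a) (C b) (p b) 1≤pa 1≤pb
        (starts-late a) (starts-late b) (proj₂ feasible a b e)

    blockLeaves : Fin n → Fin X → ℕ
    blockLeaves j i = Σ[ X ] (λ i₀ → C (leaf j i i₀))

    blocks : Fin n → ℕ
    blocks j = Σ[ X ] (λ i → C (mid j i)) + Σ[ X ] (blockLeaves j)

    cost : Fin n → ℕ
    cost j = C (orig j) + Σ[ X ] (λ i → C (mid j i)) + Σ[ X ] (blockLeaves j) + starSum C j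

    -- If j(i) finishes before X it has positive length X − u_j, so u_j ≥ 1
    -- and the leaves j(i,·), which cannot precede it, all finish after it.
    leaf-late : ∀ j i → C (mid j i) < X → ∀ i₀ → X ≤ C (leaf j i i₀)
    leaf-late j i mid<X i₀
      with ordered (eLeaf j i i₀) (1≤X∸u j)
                   (m∸n<m⇒0<n X (u j) (≤-<-trans (starts-late (mid j i)) mid<X))
    ... | inj₁ mid-first =
      ≤-trans (≤-reflexive (sym (X∸u+u≡X j)))
              (≤-trans (+-monoˡ-≤ (u j) (starts-late (mid j i))) mid-first)
    ... | inj₂ leaf-first = ⊥-elim (<-irrefl refl (≤-<-trans
      (≤-trans (≤-reflexive (trans (sym (X∸u+u≡X j)) (+-comm (X ∸ u j) (u j))))
        (≤-trans (+-monoˡ-≤ (X ∸ u j) (starts-late (leaf j i i₀))) leaf-first))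
      mid<X))

    block-cost : ∀ j i → X + X * u j ≤ C (mid j i) + blockLeaves j i
    block-cost j i with X ≤? C (mid j i)
    ... | yes X≤mid = +-mono-≤ X≤mid (*≤Σ X _ (u j) (λ i₀ → starts-late (leaf j i i₀)))
    ... | no mid<X  = ≤-trans (X+Xu≤XX j)
                        (≤-trans (*≤Σ X _ X (leaf-late j i (≰⇒> mid<X))) (m≤n+m _ _))

    block-cost-late-orig : ∀ j i → u j < C (orig j) → C (orig j) < X →
                           suc (X + X * u j) ≤ C (mid j i) + blockLeaves j i
    block-cost-late-orig j i u<o o<X with ordered (eMid j i) (s≤s z≤n) (1≤X∸u j)
    ... | inj₁ orig-first = +-mono-≤ X<mid (*≤Σ X _ (u j) (λ i₀ → starts-late (leaf j i i₀)))
      where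
      X<mid : X < C (mid j i)
      X<mid = begin-strict
        X                         ≡⟨ sym (X∸u+u≡X j) ⟩
        (X ∸ u j) + u j           <⟨ +-monoʳ-< (X ∸ u j) u<o ⟩
        (X ∸ u j) + C (orig j)    ≡⟨ +-comm (X ∸ u j) (C (orig j)) ⟩
        C (orig j) + (X ∸ u j)    ≤⟨ orig-first ⟩
        C (mid j i)               ∎
        where open ≤-Reasoning
    ... | inj₂ mid-first = +-mono-≤ (≤-trans (1≤X∸u j) (starts-late (mid j i)))
                             (≤-trans (X+Xu≤XX j) (*≤Σ X _ X (leaf-late j i mid<X)))
      where
      mid<X : C (mid j i) < X
      mid<X = <-≤-trans (m<m+n (C (mid j i)) z<s) (≤-trans mid-first (<⇒≤ o<X))

    blocks-from-block-cost : ∀ j c → (∀ i → c ≤ C (mid j i) + blockLeaves j i) → X * c ≤ blocks j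
    blocks-from-block-cost j c h = ≤-trans (*≤Σ X _ c h) (≤-reflexive (sym (Σ-distrib-+ X _ _)))

    blocks-cost : ∀ j → blocksLower j ≤ blocks j
    blocks-cost j =
      ≤-trans (≤-reflexive (square-form X (u j))) (blocks-from-block-cost j _ (block-cost j))
      where
      square-form : ∀ x v → (1 + v) * (x * x) ≡ x * (x + x * v)
      square-form = solve-∀

    blocks-cost-late-orig : ∀ j → u j < C (orig j) → C (orig j) < X → blocksLower j + X ≤ blocks j
    blocks-cost-late-orig j u<o o<X =
      ≤-trans (≤-reflexive (square-form X (u j)))
              (blocks-from-block-cost j _ (λ i → block-cost-late-orig j i u<o o<X))
      where
      square-form : ∀ x v → (1 + v) * (x * x) + x ≡ x * suc (x + x * v)
      square-form = solve-∀

    star-late : ∀ j (q : 1 < ℓ j) → C (orig j) < ℓ j → ∀ i → ℓ j ≤ C (star j q i)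
    star-late j q o<ℓ i with ordered (eStar j q i) (s≤s z≤n) (m<n⇒0<n∸m q)
    ... | inj₁ orig-first =
      ≤-trans (≤-reflexive (trans (sym (m∸n+n≡m (<⇒≤ q))) (+-comm (ℓ j ∸ 1) 1)))
              (≤-trans (+-monoˡ-≤ (ℓ j ∸ 1) (starts-late (orig j))) orig-first)
    ... | inj₂ star-first = ⊥-elim (<-irrefl refl (≤-<-trans
      (≤-trans (≤-reflexive (sym (m∸n+n≡m (<⇒≤ q))))
        (≤-trans (+-monoˡ-≤ 1 (starts-late (star j q i))) star-first))
      o<ℓ))

    stars-cost : ∀ j → starsLower j ≤ starSum C j
    stars-cost j with 1 <? ℓ j
    ... | yes q = ≤-trans (≤-reflexive (*-comm (ℓ j ∸ 1) X))
                          (*≤Σ X _ (ℓ j ∸ 1) (λ i → starts-late (star j q i)))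
    ... | no ℓ≤1 rewrite m≤n⇒m∸n≡0 (≮⇒≥ ℓ≤1) = z≤n

    stars-cost-early-orig : ∀ j → C (orig j) < ℓ j → starsLower j + X ≤ starSum C j
    stars-cost-early-orig j o<ℓ with 1 <? ℓ j
    ... | yes q = ≤-trans (≤-reflexive (pred-form (ℓ j) X q)) (*≤Σ X _ (ℓ j) (star-late j q o<ℓ))
      where
      pred-form : ∀ L x → 1 < L → (L ∸ 1) * x + x ≡ x * L
      pred-form (suc L) x _ =
        trans (+-comm (L * x) x) (trans (cong (x +_) (*-comm L x)) (sym (*-suc x L)))
    ... | no ℓ≤1 = ⊥-elim (<-irrefl refl (≤-<-trans (starts-late (orig j)) (<-≤-trans o<ℓ (≮⇒≥ ℓ≤1))))

    cost-≥ : ∀ j {a b s} → a ≤ C (orig j) → b ≤ blocks j → s ≤ starSum C j → a + b + s ≤ cost j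
    cost-≥ j a≤ b≤ s≤ = ≤-trans (+-mono-≤ (+-mono-≤ a≤ b≤) s≤)
                          (≤-reflexive (cong (_+ starSum C j) (sym (+-assoc (C (orig j)) _ _))))

    cost-≥-lower : ∀ j → lower j ≤ cost j
    cost-≥-lower j = cost-≥ j z≤n (blocks-cost j) (stars-cost j)

    cost-≥-lower+X-outside-window : ∀ j → ¬ InWindow C j → lower j + X ≤ cost j
    cost-≥-lower+X-outside-window j outside
      with ℓ j ≤? C (orig j) | C (orig j) ≤? u j | C (orig j) <? X
    ... | no o<ℓ | _ | _ =
      ≤-trans (≤-reflexive (+-assoc (blocksLower j) (starsLower j) X))
              (cost-≥ j z≤n (blocks-cost j) (stars-cost-early-orig j (≰⇒> o<ℓ)))
    ... | yes ℓ≤o | yes o≤u | _ = ⊥-elim (outside (ℓ≤o , o≤u))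
    ... | yes _ | no u<o | yes o<X =
      ≤-trans (≤-reflexive (+-swapʳ (blocksLower j) (starsLower j) X))
              (cost-≥ j z≤n (blocks-cost-late-orig j (≰⇒> u<o) o<X) (stars-cost j))
    ... | yes _ | no _ | no X≤o =
      ≤-trans (≤-reflexive (+-rotate (blocksLower j) (starsLower j) X))
              (cost-≥ j (≮⇒≥ X≤o) (blocks-cost j) (stars-cost j))

    in-window : TotalCompletion C ≤ K → ∀ j → InWindow C j
    in-window total≤K j with (ℓ j ≤? C (orig j)) ×-dec (C (orig j) ≤? u j)
    ... | yes inside = inside
    ... | no outside = ⊥-elim (<-irrefl refl (≤-<-trans X≤nk (m<m+n (n * k) z<s)))
      where
      X≤nk : X ≤ n * k
      X≤nk = +-cancelˡ-≤ (Σ[ n ] lower) _ _ (≤-trans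
        (Σ-mono-≤-with-gap n lower cost X cost-≥-lower j (cost-≥-lower+X-outside-window j outside))
        total≤K)

    adjacent-apart : ∀ {i j} → Adj H i j → C (orig i) ≢ C (orig j)
    adjacent-apart adj same with ordered (eH adj) (s≤s z≤n) (s≤s z≤n)
    ... | inj₁ i-first = <-irrefl same (≤-trans (≤-reflexive (+-comm 1 _)) i-first)
    ... | inj₂ j-first = <-irrefl (sym same) (≤-trans (≤-reflexive (+-comm 1 _)) j-first)

    module _ (window : ∀ j → InWindow C j) where
      suc-pred-completion : ∀ j → suc (C (orig j) ∸ 1) ≡ C (orig j)
      suc-pred-completion j = m+[n∸m]≡n (starts-late (orig j))

      colour-bound : ∀ j → C (orig j) ∸ 1 < k
      colour-bound j =
        ≤-trans (≤-reflexive (suc-pred-completion j)) (≤-trans (proj₂ (window j)) (u≤k j))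

      colour : Fin n → Fin k
      colour j = fromℕ< (colour-bound j)

      suc-colour : ∀ j → suc (toℕ (colour j)) ≡ C (orig j)
      suc-colour j = trans (cong suc (FP.toℕ-fromℕ< (colour-bound j))) (suc-pred-completion j)

      colour-proper : ∀ i j → Adj H i j → colour i ≢ colour j
      colour-proper i j adj same = adjacent-apart adj
        (trans (sym (suc-colour i)) (trans (cong (λ c → suc (toℕ c)) same) (suc-colour j)))

      colour-extends : ∀ j c → χ j ≡ just c → colour j ≡ c
      colour-extends j c eq =
        FP.toℕ-injective (suc-injective (trans (suc-colour j) (≤-antisym below above)))
        where
        below : C (orig j) ≤ suc (toℕ c)
        below = subst (C (orig j) ≤_) (u-precoloured eq) (proj₂ (window j))
        above : suc (toℕ c) ≤ C (orig j)
        above = subst (_≤ C (orig j)) (ℓ-precoloured eq) (proj₁ (window j))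

      solution : Σ (Fin n → Fin k) (IsSolution H χ)
      solution = colour , colour-proper , colour-extends

lemma14 : (n k : ℕ) (H : Graph n) (χ : Precoloring n k) →
          ProperPrecoloring H χ → HasEdge H →
          Σ (Construction.Schedule n k H χ) (λ C →
            Construction.Feasible n k H χ C × Construction.Minimal n k H χ C ×
            Construction.TotalCompletion n k H χ C ≤ Construction.K n k H χ) →
          Σ (Fin n → Fin k) (λ χ' → IsSolution H χ χ')
lemma14 n k H χ _ _ (C , feasible , _ , total≤K) =
  solution C feasible (in-window C feasible total≤K)
  where open Gadget n k H χ
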